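{- Let $c$, $k$ and $t$ be positive integers with $c\ge 2$ and $k\ge t+2$. If $\mathcal{F}$ and $\mathcal{G}$ are cross $t$-intersecting subfamilies of $U^{[ck]}_{c,k}$, then $$|\mathcal{F}|\le\theta(c,k,\tau_t(\mathcal{G}))\binom{\tau_t(\mathcal{F})}{t}\prod_{j=1}^{\tau_t(\mathcal{G})-t}\bigl(k-(t+j-1)\bigr).$$
   Context: $U^{[ck]}_{c,\ell}$ is the set of families of $\ell$ pairwise disjoint $c$-subsets ("blocks") of $[ck]$; members are sets of blocks, $A\cap B$ is the set of common blocks. Families are cross $t$-intersecting if any member of one and any member of the other share at least $t$ blocks. For $\mathcal{A}\subseteq U^{[ck]}_{c,\ell}$, $S\in U^{[ck]}_{c,s}$ is a $t$-cover of $\mathcal{A}$ if $|S\cap A|\ge t$ for all $A\in\mathcal{A}$; $\tau_t(\mathcal{A})$ is the minimum $s$ such that $\mathcal{A}$ has a $t$-cover in $U^{[ck]}_{c,s}$. For $z\le k$, $\theta(c,k,z)=\frac{1}{(k-z)!}\prod_{i=z}^{k-1}\binom{(k-i)c}{c}$, the number of members of $U^{[ck]}_{c,k}$ containing a fixed member of $U^{[ck]}_{c,z}$. -}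

module Defs where

open import Data.Nat using (ℕ; zero; suc; _+_; _*_; _∸_; _≤_; _<_)
open import Data.Nat.Properties using (_!≢0)
open import Data.Nat.Combinatorics using (_C_)
open import Data.Nat.DivMod using (_/_)
open import Data.Nat.Base using (_!)
open import Data.Bool using (Bool)
import Data.Bool.Properties as BoolP
open import Data.Vec.Properties using (≡-dec)
open import Data.Fin.Subset using (Subset; ∣_∣; _∩_; Empty)
open import Data.List using (List; length; filter)
open import Data.List.Relation.Unary.All using (All)
open import Data.List.Relation.Unary.AllPairs using (AllPairs)
open import Data.List.Relation.Binary.Permutation.Propositional using (_↭_)
open import Data.List.Membership.Propositional using (_∈_)
import Data.List.Membership.DecPropositional as DecMem
open import Data.Product using (Σ; _×_)
open import Relation.Binary.PropositionalEquality using (_≡_)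
open import Relation.Binary.Definitions using (DecidableEquality)
open import Relation.Nullary using (¬_)

Block : ℕ → Set
Block n = Subset n

_≟B_ : ∀ {n} → DecidableEquality (Block n)
_≟B_ = ≡-dec BoolP._≟_

-- A member (a set of blocks) is represented by a duplicate-free list of blocks;
-- two lists represent the same member iff they are permutations of each other.
Member : ℕ → Set
Member n = List (Block n)

InU : (n c ℓ : ℕ) → Member n → Set
InU n c ℓ A =
  length A ≡ ℓ
  × All (λ b → ∣ b ∣ ≡ c) A
  × AllPairs (λ b b′ → Empty (b ∩ b′)) A

inter : ∀ {n} → Member n → Member n → ℕ
inter {n} A B = length (filter (λ b → b ∈? B) A)
  where open DecMem (_≟B_ {n}) using (_∈?_)

-- A family is a finite set of members, represented by a list of members no two
-- of which represent the same member (so |F| = length F).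
Family : ℕ → Set
Family n = List (Member n)

SubfamilyU : (n c ℓ : ℕ) → Family n → Set
SubfamilyU n c ℓ F = All (InU n c ℓ) F × AllPairs (λ A B → ¬ (A ↭ B)) F

CrossIntersecting : ∀ {n} → ℕ → Family n → Family n → Set
CrossIntersecting t F G = All (λ A → All (λ B → t ≤ inter A B) G) F

IsTCover : ∀ {n} → ℕ → Family n → Member n → Set
IsTCover t F S = All (λ A → t ≤ inter S A) F

HasTCover : (n c t s : ℕ) → Family n → Set
HasTCover n c t s F = Σ (Member n) (λ S → InU n c s S × IsTCover t F S)

IsTau : (n c t : ℕ) → Family n → ℕ → Set
IsTau n c t F s = HasTCover n c t s F × (∀ s′ → s′ < s → ¬ HasTCover n c t s′ F)

prodFrom : ℕ → ℕ → (ℕ → ℕ) → ℕ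
prodFrom a zero    f = 1
prodFrom a (suc m) f = f a * prodFrom (suc a) m f

-- θ(c,k,z) = (1/(k-z)!) ∏_{i=z}^{k-1} C((k-i)c, c)   (exact division; z ≤ k)
θ : ℕ → ℕ → ℕ → ℕ
θ c k z = _/_ (prodFrom z (k ∸ z) (λ i → ((k ∸ i) * c) C c)) ((k ∸ z) !) ⦃ (k ∸ z) !≢0 ⦄

-- Let S be a t-cover of F with τ_t(F) blocks. Every member of F contains t blocks of S, so
-- |F| ≤ C(τ_t(F), t) · max_T #{A ∈ F : T ⊆ A} over t-sets T of disjoint blocks. To bound the
-- number of members of F containing a set D of d < τ_t(G) disjoint blocks: D is not a t-cover of G,
-- so some B ∈ G shares fewer than t blocks with D, while every A ∈ F shares at least t with B.
-- Hence A contains a block of B outside D, necessarily disjoint from D, and there are at most k − d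
-- of those; extend D by it and recurse. Once d = τ_t(G) the members containing D number at most
-- θ(c, k, d), which is exact counting: the block through the least point not covered by D can be
-- chosen in C(ck − dc − 1, c − 1) ways. Multiplying the branching factors k − d for t ≤ d < τ_t(G)
-- gives the bound.
module Submission where

open import Defs
open import Data.Bool using (true; false)
import Data.Bool.Properties as Bool
open import Data.Empty using (⊥-elim)
open import Data.Fin using (Fin; zero; suc)
import Data.Fin as Fin
open import Data.Fin.Subset
  using (Subset; ∣_∣; _∩_; _∪_; _─_; _-_; ⁅_⁆; ⋃; ⊥; Empty)
  renaming (_∈_ to _∈ₛ_; _∉_ to _∉ₛ_; _⊆_ to _⊆ₛ_)
open import Data.Fin.Subset.Properties
  using (drop-∷-Empty; Empty-unique; ∉⊥; ∈⊤; ∣⊥∣≡0; ∣p∣≤n; ∣p∣≡n⇒p≡⊤; ∩-idem; ⊆-antisym;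
         x∈p∩q⁺; x∈p∩q⁻; x∈p∪q⁺; x∈p∪q⁻; x∈⁅x⁆; x∈⁅y⁆⇒x≡y; ∣⁅x⁆∣≡1; x∈p∧x≢y⇒x∈p-y; p─q⊆p)
open import Data.List using (List; []; _∷_; [_]; _++_; map; length; filter)
open import Data.List.Properties using (length-map; length-++; filter-accept; filter-all)
open import Data.List.Membership.Propositional using (_∈_; _∉_; find; lose)
import Data.List.Membership.DecPropositional as DecMem
open import Data.List.Membership.Propositional.Properties
  using (∈-map⁺; ∈-map⁻; ∈-++⁺ˡ; ∈-++⁺ʳ; ∈-++⁻; ∈-∃++; ∈-filter⁺; ∈-filter⁻)
open import Data.List.Membership.Propositional.Properties.WithK using (unique∧set⇒bag)
open import Data.List.Relation.Binary.BagAndSetEquality using (∼bag⇒↭)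
open import Data.List.Relation.Binary.Permutation.Propositional using (_↭_; ↭-trans; ↭-sym)
open import Data.List.Relation.Binary.Sublist.Propositional using (_⊆_; []; _∷_; _∷ʳ_; minimum)
open import Data.List.Relation.Binary.Sublist.Propositional.Properties using (All-resp-⊆)
open import Data.List.Relation.Unary.All using (All; []; _∷_; all?)
import Data.List.Relation.Unary.All as All
import Data.List.Relation.Unary.All.Properties as All
open import Data.List.Relation.Unary.AllPairs using (AllPairs; []; _∷_)
open import Data.List.Relation.Unary.AllPairs.Properties using (filter⁺; ++⁺)
open import Data.List.Relation.Unary.Any using (here; there; any?)
open import Data.List.Relation.Unary.Unique.Propositional using (Unique)
open import Data.Nat hiding (∣_-_∣)
open import Data.Nat.Combinatorics using (_C_; nCk≡nC[n∸k]; nCn≡1; k>n⇒nCk≡0; nCk+nC[k+1]≡[n+1]C[k+1])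
open import Data.Nat.DivMod using (_/_; m*n/n≡m)
open import Data.Nat.ListAction using (sum)
open import Data.Nat.Properties
open import Algebra.Properties.CommutativeSemigroup *-commutativeSemigroup
  using (x∙yz≈y∙xz; x∙yz≈yx∙z; xy∙z≈y∙xz)
open import Data.Product using (∃; _×_; _,_; proj₁; proj₂)
open import Data.Sum using (inj₁; inj₂)
open import Data.Vec using (here; there; _∷_; [])
open import Data.Vec.Properties using (≡-dec)
open import Function using (_∘_; case_of_)
open import Function.Bundles using (mk⇔)
open import Relation.Binary.PropositionalEquality hiding ([_])
open import Relation.Nullary using (¬_; ¬?; Dec; yes; no; _×-dec_; contradiction)
open import Relation.Unary using (Decidable)

-- Pascal's recursion, which the enumerations below follow clause by clause; it agrees with _C_.
binomial : ℕ → ℕ → ℕ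
binomial n       zero    = 1
binomial zero    (suc m) = 0
binomial (suc n) (suc m) = binomial n m + binomial n (suc m)

binomial≡C : ∀ n m → binomial n m ≡ n C m
binomial≡C n       zero    = sym (trans (nCk≡nC[n∸k] (z≤n {n})) (nCn≡1 n))
binomial≡C zero    (suc m) = sym (k>n⇒nCk≡0 {n = 0} {k = suc m} (s≤s z≤n))
binomial≡C (suc n) (suc m) =
  trans (cong₂ _+_ (binomial≡C n m) (binomial≡C n (suc m))) (nCk+nC[k+1]≡[n+1]C[k+1] n m)

binomial≥1 : ∀ {n m} → m ≤ n → 1 ≤ binomial n m
binomial≥1 {m = zero}  _         = s≤s z≤n
binomial≥1 {m = suc m} (s≤s m≤n) = ≤-trans (binomial≥1 m≤n) (m≤m+n _ _)

binomial[n,1]≡n : ∀ n → binomial n 1 ≡ n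
binomial[n,1]≡n zero    = refl
binomial[n,1]≡n (suc n) = cong suc (binomial[n,1]≡n n)

binomial-absorption : ∀ n m → suc m * binomial (suc n) (suc m) ≡ suc n * binomial n m
binomial-absorption zero    zero    = refl
binomial-absorption zero    (suc m) = *-zeroʳ (suc (suc m))
binomial-absorption (suc n) zero    =
  trans (+-identityʳ _) (trans (cong suc (binomial[n,1]≡n (suc n))) (sym (*-identityʳ _)))
binomial-absorption (suc n) (suc m) = begin
  suc (suc m) * (b (suc m) + b (suc (suc m)))
    ≡⟨ *-distribˡ-+ (suc (suc m)) (b (suc m)) (b (suc (suc m))) ⟩
  (b (suc m) + suc m * b (suc m)) + suc (suc m) * b (suc (suc m))
    ≡⟨ cong₂ _+_ (cong (b (suc m) +_) (binomial-absorption n m)) (binomial-absorption n (suc m)) ⟩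
  (b (suc m) + suc n * binomial n m) + suc n * binomial n (suc m)
    ≡⟨ +-assoc (b (suc m)) _ _ ⟩
  b (suc m) + (suc n * binomial n m + suc n * binomial n (suc m))
    ≡⟨ cong (b (suc m) +_) (*-distribˡ-+ (suc n) (binomial n m) (binomial n (suc m))) ⟨
  b (suc m) + suc n * b (suc m)
    ∎
  where
  open ≡-Reasoning
  b : ℕ → ℕ
  b = binomial (suc n)

-- completions c′ e counts the partitions of e (c′ + 1) points into blocks of size c′ + 1:
-- the block of the least point is one of C(e (c′ + 1) − 1, c′) candidates.
completions : ℕ → ℕ → ℕ
completions c′ zero    = 1
completions c′ (suc e) = binomial (c′ + e * suc c′) c′ * completions c′ e

binomial-blocks : ∀ c′ e → binomial (suc e * suc c′) (suc c′) ≡ suc e * binomial (c′ + e * suc c′) c′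
binomial-blocks c′ e = *-cancelˡ-≡ _ _ (suc c′) (begin
  suc c′ * binomial (suc e * suc c′) (suc c′) ≡⟨ binomial-absorption (c′ + e * suc c′) c′ ⟩
  suc e * suc c′ * binomial (c′ + e * suc c′) c′ ≡⟨ xy∙z≈y∙xz (suc e) (suc c′) _ ⟩
  suc c′ * (suc e * binomial (c′ + e * suc c′) c′) ∎)
  where open ≡-Reasoning

prodFrom-C≡!*completions : ∀ c′ k d e → d + e ≡ k →
  prodFrom d e (λ i → ((k ∸ i) * suc c′) C suc c′) ≡ e ! * completions c′ e
prodFrom-C≡!*completions c′ k d zero    _    = refl
prodFrom-C≡!*completions c′ k d (suc e) d+e≡k = begin
  (((k ∸ d) * suc c′) C suc c′) * prodFrom (suc d) e (λ i → ((k ∸ i) * suc c′) C suc c′)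
    ≡⟨ cong₂ _*_ (cong (λ m → (m * suc c′) C suc c′) k∸d≡1+e)
                 (prodFrom-C≡!*completions c′ k (suc d) e (trans (sym (+-suc d e)) d+e≡k)) ⟩
  ((suc e * suc c′) C suc c′) * (e ! * completions c′ e)
    ≡⟨ cong (_* (e ! * completions c′ e))
            (trans (sym (binomial≡C (suc e * suc c′) (suc c′))) (binomial-blocks c′ e)) ⟩
  suc e * binomial (c′ + e * suc c′) c′ * (e ! * completions c′ e)
    ≡⟨ [m*n]*[o*p]≡[m*o]*[n*p] (suc e) (binomial (c′ + e * suc c′) c′) (e !) (completions c′ e) ⟩
  suc e ! * completions c′ (suc e)
    ∎
  where
  open ≡-Reasoning
  k∸d≡1+e : k ∸ d ≡ suc e
  k∸d≡1+e = trans (cong (_∸ d) (sym d+e≡k)) (m+n∸m≡n d (suc e))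

θ≡completions : ∀ c′ k d → d ≤ k → θ (suc c′) k d ≡ completions c′ (k ∸ d)
θ≡completions c′ k d d≤k = begin
  (prodFrom d (k ∸ d) (λ i → ((k ∸ i) * suc c′) C suc c′) / (k ∸ d) !) ⦃ (k ∸ d) !≢0 ⦄
    ≡⟨ cong (λ m → (m / (k ∸ d) !) ⦃ (k ∸ d) !≢0 ⦄)
            (trans (prodFrom-C≡!*completions c′ k d (k ∸ d) (m+[n∸m]≡n d≤k)) (*-comm ((k ∸ d) !) _)) ⟩
  (completions c′ (k ∸ d) * (k ∸ d) ! / (k ∸ d) !) ⦃ (k ∸ d) !≢0 ⦄
    ≡⟨ m*n/n≡m (completions c′ (k ∸ d)) ((k ∸ d) !) ⦃ (k ∸ d) !≢0 ⦄ ⟩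
  completions c′ (k ∸ d)
    ∎
  where open ≡-Reasoning

completions-mono : ∀ c′ {a b} → a ≤ b → completions c′ a ≤ completions c′ b
completions-mono c′ a≤b = go (≤⇒≤′ a≤b)
  where
  go : ∀ {a b} → a ≤′ b → completions c′ a ≤ completions c′ b
  go ≤′-refl              = ≤-refl
  go (≤′-step {b} a≤′b) = ≤-trans (go a≤′b)
    (m≤n*m (completions c′ b) _ ⦃ >-nonZero (binomial≥1 (m≤m+n c′ (b * suc c′))) ⦄)

prodFrom-shift : ∀ m a b (f g : ℕ → ℕ) → (∀ i → f (a + i) ≡ g (b + i)) → prodFrom a m f ≡ prodFrom b m g
prodFrom-shift zero    a b f g f≗g = refl
prodFrom-shift (suc m) a b f g f≗g = cong₂ _*_
  (trans (cong f (sym (+-identityʳ a))) (trans (f≗g 0) (cong g (+-identityʳ b))))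
  (prodFrom-shift m (suc a) (suc b) f g
    (λ i → trans (cong f (sym (+-suc a i))) (trans (f≗g (suc i)) (cong g (+-suc b i)))))

Disjoint : ∀ {n} → Subset n → Subset n → Set
Disjoint p q = Empty (p ∩ q)

module _ {n : ℕ} {p q : Subset n} where

  disjoint⁺ : (∀ {x} → x ∈ₛ p → x ∉ₛ q) → Disjoint p q
  disjoint⁺ p#q (x , x∈p∩q) = let (x∈p , x∈q) = x∈p∩q⁻ p q x∈p∩q in p#q x∈p x∈q

  disjoint⁻ : Disjoint p q → ∀ {x} → x ∈ₛ p → x ∉ₛ q
  disjoint⁻ p#q x∈p x∈q = p#q (_ , x∈p∩q⁺ (x∈p , x∈q))


disjoint-sym : ∀ {n} {p q : Subset n} → Disjoint p q → Disjoint q p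
disjoint-sym p#q = disjoint⁺ (λ x∈q x∈p → disjoint⁻ p#q x∈p x∈q)

disjoint? : ∀ {n} (p q : Subset n) → Dec (Disjoint p q)
disjoint? p q with ≡-dec Bool._≟_ (p ∩ q) ⊥
... | yes p∩q≡⊥ = yes (λ (x , x∈p∩q) → ∉⊥ (subst (x ∈ₛ_) p∩q≡⊥ x∈p∩q))
... | no  p∩q≢⊥ = no (λ p#q → p∩q≢⊥ (Empty-unique p#q))

self-disjoint⇒∣p∣≡0 : ∀ {n} (p : Subset n) → Disjoint p p → ∣ p ∣ ≡ 0
self-disjoint⇒∣p∣≡0 {n} p p#p = trans (cong ∣_∣ (trans (sym (∩-idem p)) (Empty-unique p#p))) (∣⊥∣≡0 n)

∣p∪q∣≡∣p∣+∣q∣ : ∀ {n} (p q : Subset n) → Disjoint p q → ∣ p ∪ q ∣ ≡ ∣ p ∣ + ∣ q ∣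
∣p∪q∣≡∣p∣+∣q∣ []           []           _     = refl
∣p∪q∣≡∣p∣+∣q∣ (true  ∷ p) (true  ∷ q) p#q = ⊥-elim (p#q (zero , here))
∣p∪q∣≡∣p∣+∣q∣ (true  ∷ p) (false ∷ q) p#q = cong suc (∣p∪q∣≡∣p∣+∣q∣ p q (drop-∷-Empty p#q))
∣p∪q∣≡∣p∣+∣q∣ (false ∷ p) (true  ∷ q) p#q =
  trans (cong suc (∣p∪q∣≡∣p∣+∣q∣ p q (drop-∷-Empty p#q))) (sym (+-suc ∣ p ∣ ∣ q ∣))
∣p∪q∣≡∣p∣+∣q∣ (false ∷ p) (false ∷ q) p#q = ∣p∪q∣≡∣p∣+∣q∣ p q (drop-∷-Empty p#q)

∈⋃⁻ : ∀ {n} {x : Fin n} (ps : List (Subset n)) → x ∈ₛ ⋃ ps → ∃ λ p → p ∈ ps × x ∈ₛ p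
∈⋃⁻ []       x∈⋃ = ⊥-elim (∉⊥ x∈⋃)
∈⋃⁻ (p ∷ ps) x∈⋃ with x∈p∪q⁻ p (⋃ ps) x∈⋃
... | inj₁ x∈p   = p , here refl , x∈p
... | inj₂ x∈⋃ps = let (q , q∈ps , x∈q) = ∈⋃⁻ ps x∈⋃ps in q , there q∈ps , x∈q

∈⋃⁺ : ∀ {n} {x : Fin n} {p} (ps : List (Subset n)) → p ∈ ps → x ∈ₛ p → x ∈ₛ ⋃ ps
∈⋃⁺ (p ∷ ps) (here refl) x∈p = x∈p∪q⁺ (inj₁ x∈p)
∈⋃⁺ (q ∷ ps) (there p∈ps) x∈p = x∈p∪q⁺ (inj₂ (∈⋃⁺ ps p∈ps x∈p))

module _ {n : ℕ} {p : Subset n} {ps : List (Subset n)} where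

  disjoint-⋃⁺ : All (Disjoint p) ps → Disjoint p (⋃ ps)
  disjoint-⋃⁺ p#ps = disjoint⁺ λ x∈p x∈⋃ →
    let (q , q∈ps , x∈q) = ∈⋃⁻ ps x∈⋃ in disjoint⁻ (All.lookup p#ps q∈ps) x∈p x∈q

  disjoint-⋃⁻ : Disjoint p (⋃ ps) → All (Disjoint p) ps
  disjoint-⋃⁻ p#⋃ = All.tabulate λ q∈ps → disjoint⁺ λ x∈p x∈q → disjoint⁻ p#⋃ x∈p (∈⋃⁺ ps q∈ps x∈q)

∣⋃∣≡length*c : ∀ {n} c (ps : List (Subset n)) → AllPairs Disjoint ps → All (λ p → ∣ p ∣ ≡ c) ps →
  ∣ ⋃ ps ∣ ≡ length ps * c
∣⋃∣≡length*c {n} c []       []           []           = ∣⊥∣≡0 n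
∣⋃∣≡length*c     c (p ∷ ps) (p#ps ∷ ps#) (∣p∣≡c ∷ ∣ps∣≡c) =
  trans (∣p∪q∣≡∣p∣+∣q∣ p (⋃ ps) (disjoint-⋃⁺ p#ps)) (cong₂ _+_ ∣p∣≡c (∣⋃∣≡length*c c ps ps# ∣ps∣≡c))

length*c≤n : ∀ {n} c (ps : List (Subset n)) → AllPairs Disjoint ps → All (λ p → ∣ p ∣ ≡ c) ps →
  length ps * c ≤ n
length*c≤n c ps ps# ∣ps∣≡c = subst (_≤ _) (∣⋃∣≡length*c c ps ps# ∣ps∣≡c) (∣p∣≤n (⋃ ps))

∣p∣≡n⇒x∈p : ∀ {n} (p : Subset n) (x : Fin n) → ∣ p ∣ ≡ n → x ∈ₛ p
∣p∣≡n⇒x∈p p x ∣p∣≡n = subst (x ∈ₛ_) (sym (∣p∣≡n⇒p≡⊤ ∣p∣≡n)) ∈⊤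

∣p∣<n⇒∃∉ : ∀ {n} (p : Subset n) → ∣ p ∣ < n → ∃ λ x → x ∉ₛ p
∣p∣<n⇒∃∉ (false ∷ p) _         = zero , λ ()
∣p∣<n⇒∃∉ (true  ∷ p) (s≤s ∣p∣<n) =
  let (x , x∉p) = ∣p∣<n⇒∃∉ p ∣p∣<n in suc x , λ { (there x∈p) → x∉p x∈p }

module _ {n : ℕ} {p q : Subset n} where

  false∷-disjoint : ∀ {u} → Disjoint p q → Disjoint (false ∷ p) (u ∷ q)
  false∷-disjoint p#q (suc x , there x∈p∩q) = p#q (x , x∈p∩q)

  true∷-disjoint : Disjoint p q → Disjoint (true ∷ p) (false ∷ q)
  true∷-disjoint p#q (suc x , there x∈p∩q) = p#q (x , x∈p∩q)

x∈p─q⇒x∉q : ∀ {n} {x : Fin n} (p q : Subset n) → x ∈ₛ p ─ q → x ∉ₛ q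
x∈p─q⇒x∉q (true ∷ p) (false ∷ q) here         ()
x∈p─q⇒x∉q (_    ∷ p) (_     ∷ q) (there x∈p─q) (there x∈q) = x∈p─q⇒x∉q p q x∈p─q x∈q

∣⁅x⁆∪p∣≡1+∣p∣ : ∀ {n} (x : Fin n) (p : Subset n) → x ∉ₛ p → ∣ ⁅ x ⁆ ∪ p ∣ ≡ suc ∣ p ∣
∣⁅x⁆∪p∣≡1+∣p∣ x p x∉p = trans
  (∣p∪q∣≡∣p∣+∣q∣ ⁅ x ⁆ p (disjoint⁺ λ y∈⁅x⁆ → subst (_∉ₛ p) (sym (x∈⁅y⁆⇒x≡y x y∈⁅x⁆)) x∉p))
  (cong (_+ ∣ p ∣) (∣⁅x⁆∣≡1 x))

p≡⁅x⁆∪[p-x] : ∀ {n} {x : Fin n} {p : Subset n} → x ∈ₛ p → p ≡ ⁅ x ⁆ ∪ (p - x)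
p≡⁅x⁆∪[p-x] {x = x} {p} x∈p = ⊆-antisym p⊆ ⊆p
  where
  p⊆ : p ⊆ₛ ⁅ x ⁆ ∪ (p - x)
  p⊆ {y} y∈p with y Fin.≟ x
  ... | yes refl = x∈p∪q⁺ (inj₁ (x∈⁅x⁆ x))
  ... | no  y≢x  = x∈p∪q⁺ (inj₂ (x∈p∧x≢y⇒x∈p-y y∈p y≢x))
  ⊆p : ⁅ x ⁆ ∪ (p - x) ⊆ₛ p
  ⊆p y∈ with x∈p∪q⁻ ⁅ x ⁆ (p - x) y∈
  ... | inj₁ y∈⁅x⁆ = subst (_∈ₛ p) (sym (x∈⁅y⁆⇒x≡y x y∈⁅x⁆)) x∈p
  ... | inj₂ y∈p-x = p─q⊆p p ⁅ x ⁆ y∈p-x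

subsetsAvoiding : ∀ {n} → Subset n → ℕ → List (Subset n)
subsetsAvoiding []          zero    = [ [] ]
subsetsAvoiding []          (suc m) = []
subsetsAvoiding (true  ∷ U) m       = map (false ∷_) (subsetsAvoiding U m)
subsetsAvoiding (false ∷ U) zero    = map (false ∷_) (subsetsAvoiding U zero)
subsetsAvoiding (false ∷ U) (suc m) =
  map (true ∷_) (subsetsAvoiding U m) ++ map (false ∷_) (subsetsAvoiding U (suc m))

length-subsetsAvoiding : ∀ {n} (U : Subset n) m → length (subsetsAvoiding U m) ≡ binomial (n ∸ ∣ U ∣) m
length-subsetsAvoiding []          zero    = refl
length-subsetsAvoiding []          (suc m) = refl
length-subsetsAvoiding (true  ∷ U) m       =
  trans (length-map _ (subsetsAvoiding U m)) (length-subsetsAvoiding U m)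
length-subsetsAvoiding (false ∷ U) zero    =
  trans (length-map _ (subsetsAvoiding U zero)) (length-subsetsAvoiding U zero)
length-subsetsAvoiding {suc n} (false ∷ U) (suc m) = begin
  length (map (true ∷_) (subsetsAvoiding U m) ++ map (false ∷_) (subsetsAvoiding U (suc m)))
    ≡⟨ length-++ (map (true ∷_) (subsetsAvoiding U m)) ⟩
  length (map (true ∷_) (subsetsAvoiding U m)) + length (map (false ∷_) (subsetsAvoiding U (suc m)))
    ≡⟨ cong₂ _+_ (trans (length-map _ (subsetsAvoiding U m)) (length-subsetsAvoiding U m))
                 (trans (length-map _ (subsetsAvoiding U (suc m))) (length-subsetsAvoiding U (suc m))) ⟩
  binomial (suc (n ∸ ∣ U ∣)) (suc m)
    ≡⟨ cong (λ l → binomial l (suc m)) (+-∸-assoc 1 (∣p∣≤n U)) ⟨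
  binomial (suc n ∸ ∣ U ∣) (suc m)
    ∎
  where open ≡-Reasoning

∈-subsetsAvoiding⁺ : ∀ {n} (U a : Subset n) m → Disjoint a U → ∣ a ∣ ≡ m → a ∈ subsetsAvoiding U m
∈-subsetsAvoiding⁺ []          []          zero    _    _     = here refl
∈-subsetsAvoiding⁺ (true  ∷ U) (true  ∷ a) m       a#U  _     = ⊥-elim (a#U (zero , here))
∈-subsetsAvoiding⁺ (true  ∷ U) (false ∷ a) m       a#U  ∣a∣≡m =
  ∈-map⁺ (false ∷_) (∈-subsetsAvoiding⁺ U a m (drop-∷-Empty a#U) ∣a∣≡m)
∈-subsetsAvoiding⁺ (false ∷ U) (true  ∷ a) (suc m) a#U  ∣a∣≡m =
  ∈-++⁺ˡ (∈-map⁺ (true ∷_) (∈-subsetsAvoiding⁺ U a m (drop-∷-Empty a#U) (suc-injective ∣a∣≡m)))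
∈-subsetsAvoiding⁺ (false ∷ U) (false ∷ a) zero    a#U  ∣a∣≡m =
  ∈-map⁺ (false ∷_) (∈-subsetsAvoiding⁺ U a zero (drop-∷-Empty a#U) ∣a∣≡m)
∈-subsetsAvoiding⁺ (false ∷ U) (false ∷ a) (suc m) a#U  ∣a∣≡m =
  ∈-++⁺ʳ _ (∈-map⁺ (false ∷_) (∈-subsetsAvoiding⁺ U a (suc m) (drop-∷-Empty a#U) ∣a∣≡m))

∈-subsetsAvoiding⁻ : ∀ {n} (U : Subset n) m {a} → a ∈ subsetsAvoiding U m → Disjoint a U × ∣ a ∣ ≡ m
∈-subsetsAvoiding⁻ [] zero (here refl) = (λ ()) , refl
∈-subsetsAvoiding⁻ (true ∷ U) m a∈ with ∈-map⁻ (false ∷_) a∈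
... | a , a∈′ , refl =
  let (a#U , ∣a∣≡m) = ∈-subsetsAvoiding⁻ U m a∈′ in false∷-disjoint {u = true} a#U , ∣a∣≡m
∈-subsetsAvoiding⁻ (false ∷ U) zero a∈ with ∈-map⁻ (false ∷_) a∈
... | a , a∈′ , refl =
  let (a#U , ∣a∣≡m) = ∈-subsetsAvoiding⁻ U zero a∈′ in false∷-disjoint {u = false} a#U , ∣a∣≡m
∈-subsetsAvoiding⁻ (false ∷ U) (suc m) a∈ with ∈-++⁻ (map (true ∷_) (subsetsAvoiding U m)) a∈
... | inj₁ a∈ˡ with ∈-map⁻ (true ∷_) a∈ˡ
...   | a , a∈′ , refl =
  let (a#U , ∣a∣≡m) = ∈-subsetsAvoiding⁻ U m a∈′ in true∷-disjoint a#U , cong suc ∣a∣≡m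
∈-subsetsAvoiding⁻ (false ∷ U) (suc m) a∈ | inj₂ a∈ʳ with ∈-map⁻ (false ∷_) a∈ʳ
...   | a , a∈′ , refl =
  let (a#U , ∣a∣≡m) = ∈-subsetsAvoiding⁻ U (suc m) a∈′ in false∷-disjoint {u = false} a#U , ∣a∣≡m

blocksThrough : ∀ {n} → Fin n → Subset n → ℕ → List (Subset n)
blocksThrough x U m = map (⁅ x ⁆ ∪_) (subsetsAvoiding (⁅ x ⁆ ∪ U) m)

module _ {n : ℕ} {x : Fin n} {U : Subset n} (x∉U : x ∉ₛ U) where

  length-blocksThrough : ∀ m → length (blocksThrough x U m) ≡ binomial (n ∸ suc ∣ U ∣) m
  length-blocksThrough m = begin
    length (blocksThrough x U m)            ≡⟨ length-map _ (subsetsAvoiding (⁅ x ⁆ ∪ U) m) ⟩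
    length (subsetsAvoiding (⁅ x ⁆ ∪ U) m)  ≡⟨ length-subsetsAvoiding (⁅ x ⁆ ∪ U) m ⟩
    binomial (n ∸ ∣ ⁅ x ⁆ ∪ U ∣) m          ≡⟨ cong (λ l → binomial (n ∸ l) m) (∣⁅x⁆∪p∣≡1+∣p∣ x U x∉U) ⟩
    binomial (n ∸ suc ∣ U ∣) m              ∎
    where open ≡-Reasoning

  ∈-blocksThrough⁺ : ∀ {a} m → x ∈ₛ a → Disjoint a U → ∣ a ∣ ≡ suc m → a ∈ blocksThrough x U m
  ∈-blocksThrough⁺ {a} m x∈a a#U ∣a∣≡1+m =
    subst (_∈ blocksThrough x U m) (sym a≡)
      (∈-map⁺ (⁅ x ⁆ ∪_) (∈-subsetsAvoiding⁺ _ (a - x) m a-x#⁅x⁆∪U ∣a-x∣≡m))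
    where
    a≡ : a ≡ ⁅ x ⁆ ∪ (a - x)
    a≡ = p≡⁅x⁆∪[p-x] x∈a
    a-x#⁅x⁆∪U : Disjoint (a - x) (⁅ x ⁆ ∪ U)
    a-x#⁅x⁆∪U = disjoint⁺ λ y∈a-x y∈⁅x⁆∪U → case x∈p∪q⁻ ⁅ x ⁆ U y∈⁅x⁆∪U of λ where
      (inj₁ y∈⁅x⁆) → x∈p─q⇒x∉q a ⁅ x ⁆ y∈a-x y∈⁅x⁆
      (inj₂ y∈U)   → disjoint⁻ a#U (p─q⊆p a ⁅ x ⁆ y∈a-x) y∈U
    ∣a-x∣≡m : ∣ a - x ∣ ≡ m
    ∣a-x∣≡m = suc-injective (begin
      suc ∣ a - x ∣        ≡⟨ ∣⁅x⁆∪p∣≡1+∣p∣ x (a - x) (λ x∈a-x → x∈p─q⇒x∉q a ⁅ x ⁆ x∈a-x (x∈⁅x⁆ x)) ⟨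
      ∣ ⁅ x ⁆ ∪ (a - x) ∣  ≡⟨ cong ∣_∣ a≡ ⟨
      ∣ a ∣                ≡⟨ ∣a∣≡1+m ⟩
      suc m                ∎)
      where open ≡-Reasoning

  ∈-blocksThrough⁻ : ∀ {a} m → a ∈ blocksThrough x U m → Disjoint a U × ∣ a ∣ ≡ suc m
  ∈-blocksThrough⁻ m a∈ with ∈-map⁻ (⁅ x ⁆ ∪_) a∈
  ... | s , s∈ , refl = ⁅x⁆∪s#U , trans (∣⁅x⁆∪p∣≡1+∣p∣ x s x∉s) (cong suc ∣s∣≡m)
    where
    s#⁅x⁆∪U : Disjoint s (⁅ x ⁆ ∪ U)
    s#⁅x⁆∪U = proj₁ (∈-subsetsAvoiding⁻ (⁅ x ⁆ ∪ U) m s∈)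
    ∣s∣≡m : ∣ s ∣ ≡ m
    ∣s∣≡m = proj₂ (∈-subsetsAvoiding⁻ (⁅ x ⁆ ∪ U) m s∈)
    x∉s : x ∉ₛ s
    x∉s x∈s = disjoint⁻ s#⁅x⁆∪U x∈s (x∈p∪q⁺ (inj₁ (x∈⁅x⁆ x)))
    ⁅x⁆∪s#U : Disjoint (⁅ x ⁆ ∪ s) U
    ⁅x⁆∪s#U = disjoint⁺ λ y∈⁅x⁆∪s y∈U → case x∈p∪q⁻ ⁅ x ⁆ s y∈⁅x⁆∪s of λ where
      (inj₁ y∈⁅x⁆) → x∉U (subst (_∈ₛ U) (x∈⁅y⁆⇒x≡y x y∈⁅x⁆) y∈U)
      (inj₂ y∈s)   → disjoint⁻ s#⁅x⁆∪U y∈s (x∈p∪q⁺ (inj₂ y∈U))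

module _ {X : Set} where

  Unique-⊆⇒length≤ : ∀ {xs ys : List X} → Unique xs → (∀ {z} → z ∈ xs → z ∈ ys) → length xs ≤ length ys
  Unique-⊆⇒length≤ {[]}     _          _     = z≤n
  Unique-⊆⇒length≤ {x ∷ xs} (x∉xs ∷ xs!) xs⊆ys with ∈-∃++ (xs⊆ys (here refl))
  ... | ys₁ , ys₂ , refl = begin
    suc (length xs)              ≤⟨ s≤s (Unique-⊆⇒length≤ xs! xs⊆ys₁++ys₂) ⟩
    suc (length (ys₁ ++ ys₂))    ≡⟨ cong suc (length-++ ys₁) ⟩
    suc (length ys₁ + length ys₂) ≡⟨ +-suc (length ys₁) (length ys₂) ⟨
    length ys₁ + length (x ∷ ys₂) ≡⟨ length-++ ys₁ ⟨
    length (ys₁ ++ x ∷ ys₂)      ∎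
    where
    open ≤-Reasoning
    xs⊆ys₁++ys₂ : ∀ {z} → z ∈ xs → z ∈ ys₁ ++ ys₂
    xs⊆ys₁++ys₂ z∈xs with ∈-++⁻ ys₁ (xs⊆ys (there z∈xs))
    ... | inj₁ z∈ys₁         = ∈-++⁺ˡ z∈ys₁
    ... | inj₂ (here refl)   = ⊥-elim (All.lookup x∉xs z∈xs refl)
    ... | inj₂ (there z∈ys₂) = ∈-++⁺ʳ ys₁ z∈ys₂

  AllPairs-lookup : ∀ {R : X → X → Set} {xs a b} → (∀ {u v} → R u v → R v u) → AllPairs R xs →
    a ∈ xs → b ∈ xs → a ≢ b → R a b
  AllPairs-lookup R-sym (_    ∷ _)   (here refl) (here refl) a≢b = ⊥-elim (a≢b refl)
  AllPairs-lookup R-sym (a#xs ∷ _)   (here refl) (there b∈)  _   = All.lookup a#xs b∈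
  AllPairs-lookup R-sym (b#xs ∷ _)   (there a∈)  (here refl) _   = R-sym (All.lookup b#xs a∈)
  AllPairs-lookup R-sym (_    ∷ xs!) (there a∈)  (there b∈)  a≢b = AllPairs-lookup R-sym xs! a∈ b∈ a≢b

  AllPairs-¬⇒length≤1 : ∀ {R : X → X → Set} {xs} → AllPairs (λ a b → ¬ R a b) xs →
    (∀ {a b} → a ∈ xs → b ∈ xs → R a b) → length xs ≤ 1
  AllPairs-¬⇒length≤1 {xs = []}         _                 _       = z≤n
  AllPairs-¬⇒length≤1 {xs = _ ∷ []}     _                 _       = s≤s z≤n
  AllPairs-¬⇒length≤1 {xs = _ ∷ _ ∷ _} ((¬Rab ∷ _) ∷ _) related =
    ⊥-elim (¬Rab (related (here refl) (there (here refl))))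

  AllPairs-resp-⊆ : ∀ {R : X → X → Set} {xs ys} → xs ⊆ ys → AllPairs R ys → AllPairs R xs
  AllPairs-resp-⊆ []            []           = []
  AllPairs-resp-⊆ (y ∷ʳ xs⊆ys)  (_ ∷ ys!)    = AllPairs-resp-⊆ xs⊆ys ys!
  AllPairs-resp-⊆ (refl ∷ xs⊆ys) (y#ys ∷ ys!) = All-resp-⊆ xs⊆ys y#ys ∷ AllPairs-resp-⊆ xs⊆ys ys!

  combinations : ℕ → List X → List (List X)
  combinations zero    xs       = [ [] ]
  combinations (suc t) []       = []
  combinations (suc t) (x ∷ xs) = map (x ∷_) (combinations t xs) ++ combinations (suc t) xs

  length-combinations : ∀ t xs → length (combinations t xs) ≡ binomial (length xs) t
  length-combinations zero    xs       = refl
  length-combinations (suc t) []       = refl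
  length-combinations (suc t) (x ∷ xs) = trans (length-++ (map (x ∷_) (combinations t xs)))
    (cong₂ _+_ (trans (length-map _ (combinations t xs)) (length-combinations t xs))
               (length-combinations (suc t) xs))

  ∈-combinations⁻ : ∀ t xs {T} → T ∈ combinations t xs → length T ≡ t × T ⊆ xs
  ∈-combinations⁻ zero    xs       (here refl) = refl , minimum xs
  ∈-combinations⁻ (suc t) (x ∷ xs) T∈ with ∈-++⁻ (map (x ∷_) (combinations t xs)) T∈
  ... | inj₂ T∈ʳ = let (∣T∣≡1+t , T⊆xs) = ∈-combinations⁻ (suc t) xs T∈ʳ in ∣T∣≡1+t , x ∷ʳ T⊆xs
  ... | inj₁ T∈ˡ with ∈-map⁻ (x ∷_) T∈ˡ
  ...   | T , T∈ , refl = let (∣T∣≡t , T⊆xs) = ∈-combinations⁻ t xs T∈ in cong suc ∣T∣≡t , refl ∷ T⊆xs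

  ∈-combinations⁺ : ∀ {P : X → Set} (P? : Decidable P) t xs → t ≤ length (filter P? xs) →
    ∃ λ T → T ∈ combinations t xs × All P T
  ∈-combinations⁺ P? zero    xs       _ = [] , here refl , []
  ∈-combinations⁺ P? (suc t) (x ∷ xs) t≤ with P? x
  ... | yes px = let (T , T∈ , PT) = ∈-combinations⁺ P? t xs (s≤s⁻¹ t≤) in
                 x ∷ T , ∈-++⁺ˡ (∈-map⁺ (x ∷_) T∈) , px ∷ PT
  ... | no  _  = let (T , T∈ , PT) = ∈-combinations⁺ P? (suc t) xs t≤ in
                 T , ∈-++⁺ʳ _ T∈ , PT

module _ {Y : Set} where

  sum-map-mono : (f g : Y → ℕ) (L : List Y) → (∀ {y} → y ∈ L → f y ≤ g y) → sum (map f L) ≤ sum (map g L)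
  sum-map-mono f g []      _   = z≤n
  sum-map-mono f g (y ∷ L) f≤g = +-mono-≤ (f≤g (here refl)) (sum-map-mono f g L (f≤g ∘ there))

  sum-map-mono-< : (f g : Y → ℕ) (L : List Y) {y₀ : Y} → y₀ ∈ L → f y₀ < g y₀ →
    (∀ {y} → y ∈ L → f y ≤ g y) → suc (sum (map f L)) ≤ sum (map g L)
  sum-map-mono-< f g (y ∷ L) (here refl) f<g f≤g = +-mono-≤ f<g (sum-map-mono f g L (f≤g ∘ there))
  sum-map-mono-< f g (y ∷ L) (there y₀∈L) f<g f≤g = subst (_≤ g y + sum (map g L)) (+-suc (f y) _)
    (+-mono-≤ (f≤g (here refl)) (sum-map-mono-< f g L y₀∈L f<g (f≤g ∘ there)))

  sum-map-≤ : (f : Y → ℕ) (K : ℕ) (L : List Y) → (∀ {y} → y ∈ L → f y ≤ K) → sum (map f L) ≤ length L * K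
  sum-map-≤ f K []      _   = z≤n
  sum-map-≤ f K (y ∷ L) f≤K = +-mono-≤ (f≤K (here refl)) (sum-map-≤ f K L (f≤K ∘ there))

length-filter-∷-mono : ∀ {X : Set} {R : X → Set} (R? : Decidable R) x xs →
  length (filter R? xs) ≤ length (filter R? (x ∷ xs))
length-filter-∷-mono R? x xs with R? x
... | yes _ = n≤1+n _
... | no  _ = ≤-refl

module _ {X Y : Set} {P : X → Set} (P? : Decidable P) {Q : Y → X → Set} (Q? : ∀ y → Decidable (Q y))
         (L : List Y) where

  length-filter≤sum : ∀ xs → (∀ {x} → x ∈ xs → P x → ∃ λ y → y ∈ L × Q y x) →
    length (filter P? xs) ≤ sum (map (λ y → length (filter (Q? y) xs)) L)
  length-filter≤sum []       _        = z≤n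
  length-filter≤sum (x ∷ xs) covered with P? x
  ... | no _ = ≤-trans (length-filter≤sum xs (covered ∘ there))
                 (sum-map-mono _ _ L λ {y} _ → length-filter-∷-mono (Q? y) x xs)
  ... | yes px with covered (here refl) px
  ...   | y₀ , y₀∈L , qx = ≤-trans (s≤s (length-filter≤sum xs (covered ∘ there)))
          (sum-map-mono-< _ _ L y₀∈L (≤-reflexive (sym (cong length (filter-accept (Q? y₀) qx))))
            (λ {y} _ → length-filter-∷-mono (Q? y) x xs))

  double-counting : ∀ K xs → (∀ {x} → x ∈ xs → P x → ∃ λ y → y ∈ L × Q y x) →
    (∀ {y} → y ∈ L → length (filter (Q? y) xs) ≤ K) → length (filter P? xs) ≤ length L * K
  double-counting K xs covered Q≤K =
    ≤-trans (length-filter≤sum xs covered) (sum-map-≤ _ K L Q≤K)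

disjoint-blocks-Unique : ∀ {n c′} {A : List (Subset n)} →
  All (λ b → ∣ b ∣ ≡ suc c′) A → AllPairs Disjoint A → Unique A
disjoint-blocks-Unique []               []           = []
disjoint-blocks-Unique (∣a∣≡c ∷ ∣A∣≡c) (a#A ∷ A#) =
  All.map (λ a#b a≡b → 0≢1+n (trans (sym (self-disjoint⇒∣p∣≡0 _ (subst (Disjoint _) (sym a≡b) a#b))) ∣a∣≡c))
          a#A
  ∷ disjoint-blocks-Unique ∣A∣≡c A#

module Blocks (c′ k : ℕ) where

  c : ℕ
  c = suc c′

  n : ℕ
  n = c * k

  open DecMem (_≟B_ {n}) using (_∈?_)

  _⊆?_ : (D A : Member n) → Dec (All (_∈ A) D)
  D ⊆? A = all? (_∈? A) D

  supersets : Member n → Family n → Family n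
  supersets D F = filter (D ⊆?_) F

  outside-disjoint : ∀ {A D : Member n} {a} → AllPairs Disjoint A → a ∈ A → All (_∈ A) D → a ∉ D →
    All (Disjoint a) D
  outside-disjoint A# a∈A D⊆A a∉D =
    All.tabulate λ b∈D → AllPairs-lookup disjoint-sym A# a∈A (All.lookup D⊆A b∈D) λ { refl → a∉D b∈D }

  InU⇒length≤k : ∀ {d} {D : Member n} → InU n c d D → d ≤ k
  InU⇒length≤k {d} {D} (refl , ∣D∣≡c , D#) =
    *-cancelʳ-≤ d k c (subst (d * c ≤_) (*-comm c k) (length*c≤n c D D# ∣D∣≡c))

  maximal-⊆ : ∀ {A D : Member n} → InU n c k A → InU n c k D → All (_∈ A) D → ∀ {a} → a ∈ A → a ∈ D
  maximal-⊆ {A} {D} (_ , ∣A∣≡c , A#) D∈U D⊆A {a} a∈A with a ∈? D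
  ... | yes a∈D = a∈D
  ... | no  a∉D = contradiction (InU⇒length≤k a∷D∈U) (<⇒≱ ≤-refl)
    where
    a∷D∈U : InU n c (suc k) (a ∷ D)
    a∷D∈U = let (∣D∣≡k , ∣D∣≡c , D#) = D∈U in
      cong suc ∣D∣≡k , All.lookup ∣A∣≡c a∈A ∷ ∣D∣≡c , outside-disjoint A# a∈A D⊆A a∉D ∷ D#

  n∸∣⋃∣≡[k∸d]*c : ∀ {d e} {D : Member n} → InU n c d D → d + e ≡ k → n ∸ ∣ ⋃ D ∣ ≡ e * c
  n∸∣⋃∣≡[k∸d]*c {d} {e} {D} (∣D∣≡d , ∣D∣≡c , D#) d+e≡k = begin
    n ∸ ∣ ⋃ D ∣          ≡⟨ cong₂ _∸_ n≡d*c+e*c (trans (∣⋃∣≡length*c c D D# ∣D∣≡c) (cong (_* c) ∣D∣≡d)) ⟩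
    d * c + e * c ∸ d * c ≡⟨ m+n∸m≡n (d * c) (e * c) ⟩
    e * c                ∎
    where
    open ≡-Reasoning
    n≡d*c+e*c : n ≡ d * c + e * c
    n≡d*c+e*c = trans (*-comm c k) (trans (cong (_* c) (sym d+e≡k)) (*-distribʳ-+ c d e))

  common-block-outside : ∀ {t d} {A B D : Member n} → InU n c d A →
    t ≤ inter A B → ¬ (t ≤ inter D B) → ∃ λ b → b ∈ A × b ∈ B × b ∉ D
  common-block-outside {A = A} {B} {D} (_ , ∣A∣≡c , A#) t≤A∩B t≰D∩B
    with any? (λ b → (b ∈? B) ×-dec ¬? (b ∈? D)) A
  ... | yes new  = find new
  ... | no  ¬new = contradiction
    (≤-trans t≤A∩B (Unique-⊆⇒length≤ (filter⁺ (_∈? B) (disjoint-blocks-Unique ∣A∣≡c A#)) A∩B⊆D∩B)) t≰D∩B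
    where
    A∩B⊆D∩B : ∀ {b} → b ∈ filter (_∈? B) A → b ∈ filter (_∈? B) D
    A∩B⊆D∩B {b} b∈ with ∈-filter⁻ (_∈? B) b∈ | b ∈? D
    ... | b∈A , b∈B | yes b∈D = ∈-filter⁺ (_∈? B) b∈D b∈B
    ... | b∈A , b∈B | no  b∉D = contradiction (lose b∈A (b∈B , b∉D)) ¬new

  module _ (F : Family n) (F⊆U : All (InU n c k) F) (F-distinct : AllPairs (λ A B → ¬ (A ↭ B)) F) where

    length-supersets-of-member≤1 : ∀ {D} → InU n c k D → length (supersets D F) ≤ 1
    length-supersets-of-member≤1 {D} D∈U@(_ , ∣D∣≡c , D#) =
      AllPairs-¬⇒length≤1 (filter⁺ (D ⊆?_) F-distinct) λ A∈ B∈ → ↭-trans (↭D A∈) (↭-sym (↭D B∈))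
      where
      ↭D : ∀ {A} → A ∈ supersets D F → A ↭ D
      ↭D A∈ = let (A∈F , D⊆A) = ∈-filter⁻ (D ⊆?_) A∈
                  A∈U@(_ , ∣A∣≡c , A#) = All.lookup F⊆U A∈F
        in ∼bag⇒↭ (unique∧set⇒bag (disjoint-blocks-Unique ∣A∣≡c A#) (disjoint-blocks-Unique ∣D∣≡c D#)
                     (mk⇔ (maximal-⊆ A∈U D∈U D⊆A) (All.lookup D⊆A)))

    supersets≤completions : ∀ e d (D : Member n) → InU n c d D → d + e ≡ k →
      length (supersets D F) ≤ completions c′ e
    supersets≤completions zero d D (∣D∣≡d , D-blocks) d+0≡k =
      length-supersets-of-member≤1 (trans ∣D∣≡d (trans (sym (+-identityʳ d)) d+0≡k) , D-blocks)
    supersets≤completions (suc e) d D D∈U@(∣D∣≡d , ∣D∣≡c , D#) d+1+e≡k = begin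
      length (supersets D F)       ≤⟨ double-counting (D ⊆?_) (λ b → (b ∷ D) ⊆?_) L _ F covered each ⟩
      length L * completions c′ e  ≡⟨ cong (_* completions c′ e) length-L ⟩
      completions c′ (suc e)       ∎
      where
      open ≤-Reasoning
      U : Subset n
      U = ⋃ D
      n∸∣U∣≡[1+e]*c : n ∸ ∣ U ∣ ≡ suc e * c
      n∸∣U∣≡[1+e]*c = n∸∣⋃∣≡[k∸d]*c D∈U d+1+e≡k
      x∉U : ∃ λ x → x ∉ₛ U
      x∉U = ∣p∣<n⇒∃∉ U (m∸n≢0⇒n<m (λ n∸∣U∣≡0 → 0≢1+n (trans (sym n∸∣U∣≡0) n∸∣U∣≡[1+e]*c)))
      x : Fin n
      x = proj₁ x∉U
      L : List (Subset n)
      L = blocksThrough x U c′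
      length-L : length L ≡ binomial (c′ + e * c) c′
      length-L = trans (length-blocksThrough (proj₂ x∉U) c′)
        (cong (λ m → binomial m c′) (trans (sym (pred[m∸n]≡m∸[1+n] n ∣ U ∣)) (cong pred n∸∣U∣≡[1+e]*c)))
      each : ∀ {b} → b ∈ L → length (supersets (b ∷ D) F) ≤ completions c′ e
      each b∈L = let (b#U , ∣b∣≡c) = ∈-blocksThrough⁻ (proj₂ x∉U) c′ b∈L in
        supersets≤completions e (suc d) _ (cong suc ∣D∣≡d , ∣b∣≡c ∷ ∣D∣≡c , disjoint-⋃⁻ b#U ∷ D#)
          (trans (sym (+-suc d e)) d+1+e≡k)
      covered : ∀ {A} → A ∈ F → All (_∈ A) D → ∃ λ b → b ∈ L × All (_∈ A) (b ∷ D)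
      covered A∈F D⊆A =
        let (∣A∣≡k , ∣A∣≡c , A#) = All.lookup F⊆U A∈F
            ∣⋃A∣≡n = trans (∣⋃∣≡length*c c _ A# ∣A∣≡c) (trans (cong (_* c) ∣A∣≡k) (*-comm k c))
            (a , a∈A , x∈a) = ∈⋃⁻ _ (∣p∣≡n⇒x∈p _ x ∣⋃A∣≡n)
            a∉D = λ a∈D → proj₂ x∉U (∈⋃⁺ D a∈D x∈a)
            a#U = disjoint-⋃⁺ (outside-disjoint A# a∈A D⊆A a∉D)
        in a , ∈-blocksThrough⁺ (proj₂ x∉U) c′ x∈a a#U (All.lookup ∣A∣≡c a∈A) , a∈A ∷ D⊆A

    supersets≤θ*∏ : ∀ {t τ} {G : Family n} → All (InU n c k) G → CrossIntersecting t F G →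
      (∀ s → s < τ → ¬ HasTCover n c t s G) →
      ∀ e d (D : Member n) → InU n c d D → τ ∸ d ≡ e →
      length (supersets D F) ≤ θ c k τ * prodFrom d e (k ∸_)
    -- With e = τ ∸ d truncated, this case is d ≥ τ; it includes G = ∅, where τ = 0.
    supersets≤θ*∏ {t} {τ} G⊆U cross τ-minimal zero d D D∈U τ∸d≡0 = begin
      length (supersets D F)   ≤⟨ supersets≤completions (k ∸ d) d D D∈U (m+[n∸m]≡n d≤k) ⟩
      completions c′ (k ∸ d)   ≤⟨ completions-mono c′ (∸-monoʳ-≤ k τ≤d) ⟩
      completions c′ (k ∸ τ)   ≡⟨ θ≡completions c′ k τ (≤-trans τ≤d d≤k) ⟨
      θ c k τ                  ≡⟨ *-identityʳ (θ c k τ) ⟨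
      θ c k τ * 1              ∎
      where
      open ≤-Reasoning
      d≤k : d ≤ k
      d≤k = InU⇒length≤k D∈U
      τ≤d : τ ≤ d
      τ≤d = m∸n≡0⇒m≤n τ∸d≡0
    supersets≤θ*∏ {t} {τ} {G} G⊆U cross τ-minimal (suc e) d D D∈U@(∣D∣≡d , ∣D∣≡c , D#) τ∸d≡1+e = begin
      length (supersets D F)      ≤⟨ double-counting (D ⊆?_) (λ b → (b ∷ D) ⊆?_) L K F covered each ⟩
      length L * K                ≤⟨ *-monoˡ-≤ K length-L≤k∸d ⟩
      (k ∸ d) * K                 ≡⟨ x∙yz≈y∙xz (k ∸ d) (θ c k τ) _ ⟩
      θ c k τ * prodFrom d (suc e) (k ∸_) ∎
      where
      open ≤-Reasoning
      K : ℕ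
      K = θ c k τ * prodFrom (suc d) e (k ∸_)
      d<τ : d < τ
      d<τ = m∸n≢0⇒n<m (λ τ∸d≡0 → 0≢1+n (trans (sym τ∸d≡0) τ∸d≡1+e))
      B₀-missed : ∃ λ B₀ → B₀ ∈ G × ¬ (t ≤ inter D B₀)
      B₀-missed = find (All.¬All⇒Any¬ (λ B → t ≤? inter D B) G
                         λ D-covers → τ-minimal d d<τ (D , D∈U , D-covers))
      B₀ : Member n
      B₀ = proj₁ B₀-missed
      B₀∈G : B₀ ∈ G
      B₀∈G = proj₁ (proj₂ B₀-missed)
      t≰D∩B₀ : ¬ (t ≤ inter D B₀)
      t≰D∩B₀ = proj₂ (proj₂ B₀-missed)
      B₀∈U : InU n c k B₀
      B₀∈U = All.lookup G⊆U B₀∈G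
      disjoint-from-D? : Decidable (λ b → All (Disjoint b) D)
      disjoint-from-D? b = all? (disjoint? b) D
      L : List (Subset n)
      L = filter disjoint-from-D? B₀
      length-L≤k∸d : length L ≤ k ∸ d
      length-L≤k∸d = m+n≤o⇒m≤o∸n (length L) (InU⇒length≤k L++D∈U)
        where
        L++D∈U : InU n c (length L + d) (L ++ D)
        L++D∈U = let (_ , ∣B₀∣≡c , B₀#) = B₀∈U in
          trans (length-++ L) (cong (length L +_) ∣D∣≡d) ,
          All.++⁺ (All.filter⁺ disjoint-from-D? ∣B₀∣≡c) ∣D∣≡c ,
          ++⁺ (filter⁺ disjoint-from-D? B₀#) D# (All.all-filter disjoint-from-D? B₀)
      each : ∀ {b} → b ∈ L → length (supersets (b ∷ D) F) ≤ K
      each b∈L = let (b∈B₀ , b#D) = ∈-filter⁻ disjoint-from-D? b∈L in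
        supersets≤θ*∏ G⊆U cross τ-minimal e (suc d) _
          (cong suc ∣D∣≡d , All.lookup (proj₁ (proj₂ B₀∈U)) b∈B₀ ∷ ∣D∣≡c , b#D ∷ D#)
          (trans (sym (pred[m∸n]≡m∸[1+n] τ d)) (cong pred τ∸d≡1+e))
      covered : ∀ {A} → A ∈ F → All (_∈ A) D → ∃ λ b → b ∈ L × All (_∈ A) (b ∷ D)
      covered A∈F D⊆A =
        let A∈U@(_ , _ , A#) = All.lookup F⊆U A∈F
            (b , b∈A , b∈B₀ , b∉D) = common-block-outside A∈U (All.lookup (All.lookup cross A∈F) B₀∈G) t≰D∩B₀
        in b , ∈-filter⁺ disjoint-from-D? b∈B₀ (outside-disjoint A# b∈A D⊆A b∉D) , b∈A ∷ D⊆A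

    length≤C*bound : ∀ {t s} K → HasTCover n c t s F → (∀ T → InU n c t T → length (supersets T F) ≤ K) →
      length F ≤ (s C t) * K
    length≤C*bound {t} {s} K (S , (∣S∣≡s , ∣S∣≡c , S#) , S-covers) bounded = begin
      length F
        ≡⟨ cong length (filter-all ([] ⊆?_) {F} (All.tabulate λ _ → [])) ⟨
      length (supersets [] F)
        ≤⟨ double-counting ([] ⊆?_) _⊆?_ (combinations t S) K F covered each ⟩
      length (combinations t S) * K
        ≡⟨ cong (_* K) length-combinations-S ⟩
      (s C t) * K
        ∎
      where
      open ≤-Reasoning
      length-combinations-S : length (combinations t S) ≡ s C t
      length-combinations-S =
        trans (length-combinations t S) (trans (cong (λ m → binomial m t) ∣S∣≡s) (binomial≡C s t))
      covered : ∀ {A} → A ∈ F → All (_∈ A) [] → ∃ λ T → T ∈ combinations t S × All (_∈ A) T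
      covered {A} A∈F _ = ∈-combinations⁺ (_∈? A) t S (All.lookup S-covers A∈F)
      each : ∀ {T} → T ∈ combinations t S → length (supersets T F) ≤ K
      each T∈ = let (∣T∣≡t , T⊆S) = ∈-combinations⁻ t S T∈ in
        bounded _ (∣T∣≡t , All-resp-⊆ T⊆S ∣S∣≡c , AllPairs-resp-⊆ T⊆S S#)

lemma2p2 : (c k t : ℕ) → 2 ≤ c → 1 ≤ t → t + 2 ≤ k →
    (F G : Family (c * k)) →
    SubfamilyU (c * k) c k F → SubfamilyU (c * k) c k G →
    CrossIntersecting t F G →
    (τF τG : ℕ) → IsTau (c * k) c t F τF → IsTau (c * k) c t G τG →
    length F ≤ θ c k τG * (τF C t) * prodFrom 1 (τG ∸ t) (λ j → k ∸ (t + j ∸ 1))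
lemma2p2 (suc c′) k t _ _ _ F G (F⊆U , F-distinct) (G⊆U , _) cross τF τG (F-cover , _) (_ , τG-minimal) =
  begin
    length F
      ≤⟨ length≤C*bound F F⊆U F-distinct K F-cover supersets≤K ⟩
    (τF C t) * K
      ≡⟨ x∙yz≈yx∙z (τF C t) (θ c k τG) _ ⟩
    θ c k τG * (τF C t) * prodFrom t (τG ∸ t) (k ∸_)
      ≡⟨ cong (θ c k τG * (τF C t) *_)
              (prodFrom-shift (τG ∸ t) t 1 _ _ λ i → cong (λ m → k ∸ (m ∸ 1)) (sym (+-suc t i))) ⟩
    θ c k τG * (τF C t) * prodFrom 1 (τG ∸ t) (λ j → k ∸ (t + j ∸ 1))
      ∎
  where
  open ≤-Reasoning
  open Blocks c′ k
  K : ℕ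
  K = θ c k τG * prodFrom t (τG ∸ t) (k ∸_)
  supersets≤K : ∀ T → InU n c t T → length (supersets T F) ≤ K
  supersets≤K T T∈U = supersets≤θ*∏ F F⊆U F-distinct G⊆U cross τG-minimal (τG ∸ t) t T T∈U refl
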